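{- The generating function $\sum_P x^{\mathrm{col}(P)}$, summed over Stanley polyominoes $P$ with $\mathrm{point}(P)=0$, equals \[ \frac{x(1-x)}{1-2x}, \] and for $n\geq 2$ the coefficient of $x^n$ in this series is $2^{n-2}$.
   Context: Cells are unit squares $[i,i+1]\times[j,j+1]$ with $i,j\in\mathbb{Z}$. A Stanley polyomino (up to translation) is a set of cells forming $k\geq 1$ rows $0,\dots,k-1$ (bottom to top), row $j$ consisting of the cells with $s_j\le i\le e_j$ ($s_j\le e_j$ integers), such that $s_{j-1}<s_j\le e_{j-1}<e_j$ for $1\le j\le k-1$. $\mathrm{col}(P)=e_{k-1}-s_0+1$ is the number of columns, and $\mathrm{point}(P)$ is the number of interior points of $P$, i.e. lattice points belonging to exactly four cells of $P$. -}

module Defs where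

open import Data.Integer using (ℤ; +_; _+_; _-_; _≤_; _<_)
open import Data.Nat using (ℕ)
open import Data.Fin using (Fin; toℕ)
open import Data.List using (List; []; _∷_; length; lookup)
open import Data.List.Relation.Unary.All using (All)
open import Data.List.Relation.Unary.Linked using (Linked)
open import Data.Product using (_×_; _,_; Σ; proj₁; proj₂)
open import Relation.Binary.PropositionalEquality using (_≡_)
open import Relation.Nullary using (¬_)
open import Data.Empty using (⊥)

-- A polyomino given by its rows: the j-th entry of the list (j = 0 is the
-- bottom row) is the pair (s_j , e_j); row j consists of the cells
-- [i,i+1]×[j,j+1] with s_j ≤ i ≤ e_j.
Rows : Set
Rows = List (ℤ × ℤ)

Adjacent : ℤ × ℤ → ℤ × ℤ → Set
Adjacent (s₀ , e₀) (s₁ , e₁) = (s₀ < s₁) × (s₁ ≤ e₀) × (e₀ < e₁)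

RowOK : ℤ × ℤ → Set
RowOK (s , e) = s ≤ e

-- Normalisation of the translation class: the bottom row starts at s_0 = 0
-- (and the rows are placed at heights 0,…,k-1); k ≥ 1.
Normalised : Rows → Set
Normalised [] = ⊥
Normalised ((s , e) ∷ _) = s ≡ + 0

IsStanley : Rows → Set
IsStanley P = Normalised P × All RowOK P × Linked Adjacent P

lastEnd : ℤ × ℤ → Rows → ℤ
lastEnd (s , e) [] = e
lastEnd _ (r ∷ rs) = lastEnd r rs

-- col(P) = e_{k-1} - s_0 + 1  (0 for the empty list, which is not a polyomino)
col : Rows → ℤ
col [] = + 0
col ((s , e) ∷ rs) = lastEnd (s , e) rs - s + + 1

Cell : Rows → ℤ → ℤ → Set
Cell P i j = Σ (Fin (length P)) λ r →
  (j ≡ + toℕ r) × (proj₁ (lookup P r) ≤ i) × (i ≤ proj₂ (lookup P r))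

-- the lattice point (a,b) belongs to exactly four cells of P, i.e. all four
-- cells having (a,b) as a corner belong to P
InteriorPoint : Rows → ℤ → ℤ → Set
InteriorPoint P a b =
  Cell P (a - + 1) (b - + 1) × Cell P a (b - + 1) ×
  Cell P (a - + 1) b × Cell P a b

NoInteriorPoint : Rows → Set
NoInteriorPoint P = ∀ a b → ¬ InteriorPoint P a b

{-# OPTIONS --safe #-}

-- Rows j-1 and j of a Stanley polyomino share the columns s_j,…,e_{j-1}, so
-- the line between them carries e_{j-1} - s_j interior points.  Hence
-- point(P) = 0 exactly when s_j = e_{j-1} for all j: each row starts in the
-- column where the previous one ends.  Such a polyomino with n ≥ 2 columns,
-- normalised to s_0 = 0, is determined by its row ends e_0 < … < e_{k-2},
-- which form an arbitrary subset of the columns 1,…,n-2; this gives 2^(n-2)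
-- polyominoes.  For n = 1 there is only the single cell.

module Submission where

open import Defs
open import Data.Nat using (ℕ; _^_; _∸_; _≤_)
open import Data.Integer using (+_)
open import Data.List using (List; length)
open import Data.List.Membership.Propositional using (_∈_)
open import Data.List.Relation.Unary.Unique.Propositional using (Unique)
open import Data.Product using (Σ; _×_)
open import Function.Bundles using (_⇔_)
open import Relation.Binary.PropositionalEquality using (_≡_)

open import Data.Bool using (Bool; true; false)
open import Data.Empty using (⊥-elim)
open import Data.Fin using (Fin; toℕ)
open import Data.Integer as ℤ using (ℤ; +<+; +≤+; -1ℤ; _-_)
import Data.Integer.Properties as ℤ
open import Data.List
  using ([]; _∷_; [_]; _++_; map; lookup; head; cartesianProductWith)
import Data.List.Properties as List
open import Data.List.Membership.Propositional.Properties
  using (∈-map⁺; ∈-map⁻; ∈-cartesianProductWith⁺; ∈-cartesianProductWith⁻)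
open import Data.List.Relation.Unary.All as All using (All; []; _∷_)
open import Data.List.Relation.Unary.AllPairs using ([]; _∷_)
open import Data.List.Relation.Unary.Any using (here; there)
open import Data.List.Relation.Unary.Linked as Linked using (Linked; []; [-]; _∷_; _∷′_)
import Data.List.Relation.Unary.Unique.Propositional.Properties as Unique
open import Data.Maybe using (just)
open import Data.Maybe.Relation.Binary.Connected using (Connected; just)
open import Data.Nat as ℕ using (zero; suc; z≤n; s≤s; _≤‴_; ≤‴-refl; ≤‴-step)
import Data.Nat.Properties as ℕ
open import Data.Product using (_,_; proj₁; proj₂; ∃; ∃₂)
open import Function.Bundles using (mk⇔)
open import Relation.Binary.PropositionalEquality
  using (_≢_; refl; sym; trans; cong; cong₂; subst; module ≡-Reasoning)
open import Relation.Nullary using (¬_; yes; no)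

module _ {a b c} {A : Set a} {B : Set b} {C : Set c} where

  length-cartesianProductWith : ∀ (f : A → B → C) xs ys →
    length (cartesianProductWith f xs ys) ≡ length xs ℕ.* length ys
  length-cartesianProductWith f []       ys = refl
  length-cartesianProductWith f (x ∷ xs) ys = begin
    length (map (f x) ys ++ cartesianProductWith f xs ys)
      ≡⟨ List.length-++ (map (f x) ys) ⟩
    length (map (f x) ys) ℕ.+ length (cartesianProductWith f xs ys)
      ≡⟨ cong₂ ℕ._+_ (List.length-map (f x) ys) (length-cartesianProductWith f xs ys) ⟩
    length ys ℕ.+ length xs ℕ.* length ys
      ∎
    where open ≡-Reasoning

module _ {a} {A : Set a} where

  words : List A → ℕ → List (List A)
  words xs zero    = [ [] ]
  words xs (suc m) = cartesianProductWith _∷_ xs (words xs m)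

  length-words : ∀ xs m → length (words xs m) ≡ length xs ^ m
  length-words xs zero    = refl
  length-words xs (suc m) =
    trans (length-cartesianProductWith _∷_ xs (words xs m))
          (cong (length xs ℕ.*_) (length-words xs m))

  Unique-words : ∀ {xs} m → Unique xs → Unique (words xs m)
  Unique-words zero    _   = [] ∷ []
  Unique-words (suc m) unique =
    Unique.cartesianProductWith⁺ _∷_ List.∷-injective unique (Unique-words m unique)

  ∈-words⁺ : ∀ {xs w} → All (_∈ xs) w → w ∈ words xs (length w)
  ∈-words⁺ []         = here refl
  ∈-words⁺ (x∈ ∷ w∈) = ∈-cartesianProductWith⁺ _∷_ x∈ (∈-words⁺ w∈)

  ∈-words⁻ : ∀ {xs w} m → w ∈ words xs m → length w ≡ m
  ∈-words⁻ zero    (here refl) = refl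
  ∈-words⁻ {xs} (suc m) w∈ with ∈-cartesianProductWith⁻ _∷_ xs (words xs m) w∈
  ... | _ , _ , _ , v∈ , refl = cong suc (∈-words⁻ m v∈)

bits : List Bool
bits = true ∷ false ∷ []

Unique-bits : Unique bits
Unique-bits = ((λ ()) ∷ []) ∷ [] ∷ []

∈-bits : ∀ b → b ∈ bits
∈-bits true  = here refl
∈-bits false = there (here refl)

suc[i-1]≡i : ∀ i → ℤ.suc (i - + 1) ≡ i
suc[i-1]≡i i = trans (cong ℤ.suc (ℤ.+-comm i -1ℤ)) (ℤ.suc-pred i)

suc[i]-1≡i : ∀ i → ℤ.suc i - + 1 ≡ i
suc[i]-1≡i i = trans (ℤ.+-comm (ℤ.suc i) -1ℤ) (ℤ.pred-suc i)

i≰i-1 : ∀ i → ¬ (i ℤ.≤ i - + 1)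
i≰i-1 i i≤i-1 =
  ℤ.<-irrefl refl (ℤ.i≤pred[j]⇒i<j (subst (i ℤ.≤_) (ℤ.+-comm i -1ℤ) i≤i-1))

Linked-lookup-consecutive : ∀ {a ℓ} {A : Set a} {R : A → A → Set ℓ} {xs} →
  Linked R xs → (i j : Fin (length xs)) → toℕ j ≡ suc (toℕ i) →
  R (lookup xs i) (lookup xs j)
Linked-lookup-consecutive (Rxy ∷ _)   Fin.zero    (Fin.suc Fin.zero) _  = Rxy
Linked-lookup-consecutive (_ ∷ Rxs)   (Fin.suc i) (Fin.suc j)        eq =
  Linked-lookup-consecutive Rxs i j (ℕ.suc-injective eq)
Linked-lookup-consecutive (_ ∷ _)     Fin.zero    (Fin.suc (Fin.suc j)) ()
Linked-lookup-consecutive (_ ∷ _)     _           Fin.zero           ()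
Linked-lookup-consecutive [-]         Fin.zero    Fin.zero           ()

Tight : ℤ × ℤ → ℤ × ℤ → Set
Tight (s₀ , e₀) (s₁ , e₁) = (s₀ ℤ.< s₁) × (s₁ ≡ e₀) × (e₀ ℤ.< e₁)

Tight⇒Adjacent : ∀ {x y} → Tight x y → Adjacent x y
Tight⇒Adjacent (s₀<s₁ , refl , e₀<e₁) = s₀<s₁ , ℤ.≤-refl , e₀<e₁

tight⇒noInteriorPoint : ∀ {P} → Linked Tight P → NoInteriorPoint P
tight⇒noInteriorPoint {P} tight a b
  (_ , (i , b-1≡i , _ , a≤eᵢ) , (j , b≡j , sⱼ≤a-1 , _) , _) =
  i≰i-1 a (ℤ.≤-trans a≤eᵢ (subst (ℤ._≤ a - + 1) sⱼ≡eᵢ sⱼ≤a-1))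
  where
  j≡1+i : toℕ j ≡ suc (toℕ i)
  j≡1+i = ℤ.+-injective (trans (sym b≡j) (trans (sym (suc[i-1]≡i b)) (cong ℤ.suc b-1≡i)))
  sⱼ≡eᵢ : proj₁ (lookup P j) ≡ proj₂ (lookup P i)
  sⱼ≡eᵢ = proj₁ (proj₂ (Linked-lookup-consecutive tight i j j≡1+i))

cell-there : ∀ {x Q i j} → Cell Q i j → Cell (x ∷ Q) i (ℤ.suc j)
cell-there (r , j≡r , sᵣ≤i , i≤eᵣ) = Fin.suc r , cong ℤ.suc j≡r , sᵣ≤i , i≤eᵣ

noInteriorPoint-tail : ∀ {x Q} → NoInteriorPoint (x ∷ Q) → NoInteriorPoint Q
noInteriorPoint-tail {x} {Q} ni a b (c₁ , c₂ , c₃ , c₄) =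
  ni a (ℤ.suc b) (lower (cell-there c₁) , lower (cell-there c₂) , cell-there c₃ , cell-there c₄)
  where
  lower : ∀ {i} → Cell (x ∷ Q) i (ℤ.suc (b - + 1)) → Cell (x ∷ Q) i (ℤ.suc b - + 1)
  lower = subst (Cell (x ∷ Q) _) (sym (ℤ.+-assoc (+ 1) b -1ℤ))

overlap⇒interiorPoint : ∀ {s₀ e₀ s₁ e₁ Q} → Adjacent (s₀ , e₀) (s₁ , e₁) → s₁ ℤ.< e₀ →
  InteriorPoint ((s₀ , e₀) ∷ (s₁ , e₁) ∷ Q) (ℤ.suc s₁) (+ 1)
overlap⇒interiorPoint {s₀} {e₀} {s₁} {e₁} {Q} (s₀<s₁ , s₁≤e₀ , e₀<e₁) s₁<e₀ =
  left (bottom s₀≤s₁ s₁≤e₀) , bottom (ℤ.≤-trans s₀≤s₁ (ℤ.i≤suc[i] s₁)) s₁+1≤e₀ ,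
  left (top ℤ.≤-refl (ℤ.≤-trans s₁≤e₀ e₀≤e₁)) , top (ℤ.i≤suc[i] s₁) (ℤ.≤-trans s₁+1≤e₀ e₀≤e₁)
  where
  P = (s₀ , e₀) ∷ (s₁ , e₁) ∷ Q
  s₀≤s₁ = ℤ.<⇒≤ s₀<s₁
  e₀≤e₁ = ℤ.<⇒≤ e₀<e₁
  s₁+1≤e₀ = ℤ.i<j⇒suc[i]≤j s₁<e₀
  bottom : ∀ {i} → s₀ ℤ.≤ i → i ℤ.≤ e₀ → Cell P i (+ 0)
  bottom s₀≤i i≤e₀ = Fin.zero , refl , s₀≤i , i≤e₀
  top : ∀ {i} → s₁ ℤ.≤ i → i ℤ.≤ e₁ → Cell P i (+ 1)
  top s₁≤i i≤e₁ = Fin.suc Fin.zero , refl , s₁≤i , i≤e₁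
  left : ∀ {j} → Cell P s₁ j → Cell P (ℤ.suc s₁ - + 1) j
  left = subst (λ i → Cell P i _) (sym (suc[i]-1≡i s₁))

adjacent⇒tight : ∀ {x y Q} → Adjacent x y → NoInteriorPoint (x ∷ y ∷ Q) → Tight x y
adjacent⇒tight {_ , e₀} {s₁ , _} adj@(s₀<s₁ , s₁≤e₀ , e₀<e₁) ni with s₁ ℤ.≟ e₀
... | yes s₁≡e₀ = s₀<s₁ , s₁≡e₀ , e₀<e₁
... | no  s₁≢e₀ = ⊥-elim (ni _ _ (overlap⇒interiorPoint adj (ℤ.≤∧≢⇒< s₁≤e₀ s₁≢e₀)))

noInteriorPoint⇒tight : ∀ {P} → Linked Adjacent P → NoInteriorPoint P → Linked Tight P
noInteriorPoint⇒tight []           _  = []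
noInteriorPoint⇒tight [-]          _  = [-]
noInteriorPoint⇒tight (adj ∷ adjs) ni =
  adjacent⇒tight adj ni ∷ noInteriorPoint⇒tight adjs (noInteriorPoint-tail ni)

-- staircase s e bs: the current row starts at s and so far reaches e; the
-- next bit says whether the row ends at e (and the next row starts there) or
-- grows by one cell.
staircase : ℕ → ℕ → List Bool → Rows
staircase s e []           = [ (+ s , + e) ]
staircase s e (true  ∷ bs) = (+ s , + e) ∷ staircase e (suc e) bs
staircase s e (false ∷ bs) = staircase s (suc e) bs

staircase-head : ∀ s e bs →
  ∃₂ λ e′ rest → e ≤ e′ × staircase s e bs ≡ (+ s , + e′) ∷ rest
staircase-head s e []           = e , [] , ℕ.≤-refl , refl
staircase-head s e (true  ∷ bs) = e , _ , ℕ.≤-refl , refl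
staircase-head s e (false ∷ bs) with staircase-head s (suc e) bs
... | e′ , rest , e<e′ , eq = e′ , rest , ℕ.<⇒≤ e<e′ , eq

staircase≢[] : ∀ {s e} bs → staircase s e bs ≢ []
staircase≢[] {s} {e} bs eq with staircase-head s e bs
... | _ , _ , _ , eq′ with trans (sym eq) eq′
... | ()

staircase-suc≢ : ∀ {s e rows} bs → staircase s (suc e) bs ≢ (+ s , + e) ∷ rows
staircase-suc≢ {s} {e} bs eq with staircase-head s (suc e) bs
... | e′ , _ , e<e′ , eq′ =
  ℕ.<⇒≢ e<e′ (ℤ.+-injective (cong proj₂ (List.∷-injectiveˡ (trans (sym eq) eq′))))

staircase-injective : ∀ {s e} as bs → staircase s e as ≡ staircase s e bs → as ≡ bs
staircase-injective []           []           _  = refl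
staircase-injective []           (true  ∷ bs) eq = ⊥-elim (staircase≢[] bs (sym (List.∷-injectiveʳ eq)))
staircase-injective []           (false ∷ bs) eq = ⊥-elim (staircase-suc≢ bs (sym eq))
staircase-injective (true  ∷ as) []           eq = ⊥-elim (staircase≢[] as (List.∷-injectiveʳ eq))
staircase-injective (true  ∷ as) (true  ∷ bs) eq =
  cong (true ∷_) (staircase-injective as bs (List.∷-injectiveʳ eq))
staircase-injective (true  ∷ as) (false ∷ bs) eq = ⊥-elim (staircase-suc≢ bs (sym eq))
staircase-injective (false ∷ as) []           eq = ⊥-elim (staircase-suc≢ as eq)
staircase-injective (false ∷ as) (true  ∷ bs) eq = ⊥-elim (staircase-suc≢ as eq)
staircase-injective (false ∷ as) (false ∷ bs) eq = cong (false ∷_) (staircase-injective as bs eq)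

staircase-tight : ∀ {s e} bs → s ℕ.< e → Linked Tight (staircase s e bs)
staircase-tight []           _   = [-]
staircase-tight {s} {e} (true ∷ bs) s<e = tight-step ∷′ staircase-tight bs (ℕ.n<1+n e)
  where
  tight-step : Connected Tight (just (+ s , + e)) (head (staircase e (suc e) bs))
  tight-step with staircase-head e (suc e) bs
  ... | _ , _ , e<e′ , eq rewrite eq = just (+<+ s<e , refl , +<+ e<e′)
staircase-tight (false ∷ bs) s<e = staircase-tight bs (ℕ.m<n⇒m<1+n s<e)

¬tight-staircase-true : ∀ {s} bs → ¬ Linked Tight (staircase s s (true ∷ bs))
¬tight-staircase-true {s} bs tight with staircase-head s (suc s) bs
... | _ , _ , _ , eq
  with subst (λ xs → Connected Tight (just (+ s , + s)) (head xs)) eq (Linked.head′ tight)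
... | just (+<+ s<s , _) = ℕ.<-irrefl refl s<s

All-RowOK-staircase : ∀ {s e} bs → s ≤ e → All RowOK (staircase s e bs)
All-RowOK-staircase []           s≤e = +≤+ s≤e ∷ []
All-RowOK-staircase {e = e} (true ∷ bs) s≤e = +≤+ s≤e ∷ All-RowOK-staircase bs (ℕ.n≤1+n e)
All-RowOK-staircase (false ∷ bs) s≤e = All-RowOK-staircase bs (ℕ.m≤n⇒m≤1+n s≤e)

staircase-normalised : ∀ e bs → Normalised (staircase 0 e bs)
staircase-normalised e bs with staircase-head 0 e bs
... | _ , _ , _ , eq = subst Normalised (sym eq) refl

staircase-isStanley : ∀ bs → IsStanley (staircase 0 1 bs)
staircase-isStanley bs =
  staircase-normalised 1 bs ,
  All-RowOK-staircase bs z≤n ,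
  Linked.map Tight⇒Adjacent (staircase-tight bs (s≤s z≤n))

lastEnd-staircase : ∀ r s e bs → lastEnd r (staircase s e bs) ≡ + (e ℕ.+ length bs)
lastEnd-staircase r s e []           = cong +_ (sym (ℕ.+-identityʳ e))
lastEnd-staircase r s e (true  ∷ bs) =
  trans (lastEnd-staircase _ e (suc e) bs) (cong +_ (sym (ℕ.+-suc e (length bs))))
lastEnd-staircase r s e (false ∷ bs) =
  trans (lastEnd-staircase r s (suc e) bs) (cong +_ (sym (ℕ.+-suc e (length bs))))

col-normalised : ∀ {P} r → Normalised P → col P ≡ lastEnd r P ℤ.+ + 1
col-normalised {(_ , e) ∷ rs} _ refl = cong (ℤ._+ + 1) (ℤ.+-identityʳ (lastEnd (+ 0 , e) rs))

col-staircase : ∀ bs → col (staircase 0 1 bs) ≡ + (2 ℕ.+ length bs)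
col-staircase bs = begin
  col (staircase 0 1 bs)                   ≡⟨ col-normalised r (staircase-normalised 1 bs) ⟩
  lastEnd r (staircase 0 1 bs) ℤ.+ + 1     ≡⟨ cong (ℤ._+ + 1) (lastEnd-staircase r 0 1 bs) ⟩
  + (suc (length bs) ℕ.+ 1)                ≡⟨ cong +_ (ℕ.+-comm (suc (length bs)) 1) ⟩
  + (2 ℕ.+ length bs)                      ∎
  where open ≡-Reasoning
        r = (+ 0 , + 0)

staircase-complete : ∀ {s e e′} rest → e ≤‴ e′ → Linked Tight ((+ s , + e′) ∷ rest) →
  ∃ λ bs → staircase s e bs ≡ (+ s , + e′) ∷ rest
staircase-complete []       ≤‴-refl [-] = [] , refl
staircase-complete (_ ∷ rest) ≤‴-refl ((_ , refl , +<+ e<e″) ∷ tight)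
  with staircase-complete rest (ℕ.≤⇒≤‴ e<e″) tight
... | bs , eq = true ∷ bs , cong (_ ∷_) eq
staircase-complete rest (≤‴-step e<e′) tight with staircase-complete rest e<e′ tight
... | bs , eq = false ∷ bs , eq

tight⇒staircase : ∀ {P} → Normalised P → All RowOK P → Linked Tight P →
  ∃ λ bs → staircase 0 0 bs ≡ P
tight⇒staircase {_ ∷ rest} refl (+≤+ _ ∷ _) tight = staircase-complete rest ℕ.0≤‴n tight

noInteriorPolyominoes : ℕ → List Rows
noInteriorPolyominoes zero          = []
noInteriorPolyominoes (suc zero)    = [ staircase 0 0 [] ]
noInteriorPolyominoes (suc (suc m)) = map (staircase 0 1) (words bits m)

Unique-noInteriorPolyominoes : ∀ n → Unique (noInteriorPolyominoes n)
Unique-noInteriorPolyominoes zero          = []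
Unique-noInteriorPolyominoes (suc zero)    = [] ∷ []
Unique-noInteriorPolyominoes (suc (suc m)) =
  Unique.map⁺ (staircase-injective _ _) (Unique-words m Unique-bits)

∈-noInteriorPolyominoes⁺ : ∀ n {P} → P ∈ noInteriorPolyominoes n →
  IsStanley P × col P ≡ + n × NoInteriorPoint P
∈-noInteriorPolyominoes⁺ (suc zero) (here refl) =
  (refl , +≤+ z≤n ∷ [] , [-]) , refl , tight⇒noInteriorPoint [-]
∈-noInteriorPolyominoes⁺ (suc (suc m)) P∈ with ∈-map⁻ (staircase 0 1) P∈
... | bs , bs∈ , refl =
  staircase-isStanley bs ,
  trans (col-staircase bs) (cong (λ l → + (2 ℕ.+ l)) (∈-words⁻ m bs∈)) ,
  tight⇒noInteriorPoint (staircase-tight bs (s≤s z≤n))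

∈-noInteriorPolyominoes⁻ : ∀ n {P} → IsStanley P × col P ≡ + n × NoInteriorPoint P →
  P ∈ noInteriorPolyominoes n
∈-noInteriorPolyominoes⁻ n ((normalised , rowsOK , adjacent) , colP≡n , ni)
  with noInteriorPoint⇒tight adjacent ni
... | tight with tight⇒staircase normalised rowsOK tight
... | [] , refl =
  subst (λ n → _ ∈ noInteriorPolyominoes n) (ℤ.+-injective colP≡n) (here refl)
... | true ∷ bs , refl = ⊥-elim (¬tight-staircase-true bs tight)
... | false ∷ bs , refl =
  subst (λ n → _ ∈ noInteriorPolyominoes n)
        (ℤ.+-injective (trans (sym (col-staircase bs)) colP≡n))
        (∈-map⁺ (staircase 0 1) (∈-words⁺ (All.universal ∈-bits bs)))

length-noInteriorPolyominoes : ∀ n → 2 ≤ n → length (noInteriorPolyominoes n) ≡ 2 ^ (n ∸ 2)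
length-noInteriorPolyominoes (suc zero)    (s≤s ())
length-noInteriorPolyominoes (suc (suc m)) _ =
  trans (List.length-map (staircase 0 1) (words bits m)) (length-words bits m)

corollary2p5 : (n : ℕ) → Σ (List Rows) λ L →
    Unique L ×
    (∀ P → P ∈ L ⇔ (IsStanley P × col P ≡ + n × NoInteriorPoint P)) ×
    (n ≡ 0 → length L ≡ 0) ×
    (n ≡ 1 → length L ≡ 1) ×
    (2 ≤ n → length L ≡ 2 ^ (n ∸ 2))
corollary2p5 n =
  noInteriorPolyominoes n ,
  Unique-noInteriorPolyominoes n ,
  (λ P → mk⇔ (∈-noInteriorPolyominoes⁺ n) (∈-noInteriorPolyominoes⁻ n)) ,
  (λ { refl → refl }) ,
  (λ { refl → refl }) ,
  length-noInteriorPolyominoes n
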